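{- Let $(G_x,\mathrm{lab}_x)=\rho_{i\to\{i,j\}}(G_y,\mathrm{lab}_y)$ for labels $i\ne j\in[k]$ and a multi-$k$-labeled graph $(G_y,\mathrm{lab}_y)$, and let $\mathcal{S}_y$ be the set of footprints of $(G_y,\mathrm{lab}_y)$. Then the set of footprints of $(G_x,\mathrm{lab}_x)$ is $\mathcal{S}_x=\{(\tilde I,\ \psi[i\mapsto\psi(i)-r,\ j\mapsto\psi(j)+r],\ \ell) : (I,\psi,\ell)\in\mathcal{S}_y,\ r\in[\psi(i)]_0\}$, where $\tilde I=I$ if $i\notin I$ and $\tilde I=I\cup\{j\}$ if $i\in I$.
   Context: Fix a graph $G$ on $n$ vertices; all labeled graphs considered have at most $n$ vertices. $[m]_0=\{0,1,\dots,m\}$. $\rho_{i\to\{i,j\}}$ keeps the graph and adds $j$ to every label set containing $i$. For a function $f$, $f[a_1\mapsto b_1,a_2\mapsto b_2]$ is the function agreeing with $f$ except that it maps $a_1$ to $b_1$ and $a_2$ to $b_2$. For a multi-$k$-labeled graph $(H,\mathrm{lab})$ ($\mathrm{lab}:V(H)\to2^{[k]}$), a partial solution is a pair $(S,M)$ where $S$ is a vertex cover of $H$ and $M$ a matching of $H$ with $V(M)\subseteq S$. A label choice for $(S,M)$ is $\phi:S\setminus V(M)\to[k]$ with $\phi(w)\in\mathrm{lab}(w)$. The footprint of $(S,M)$ and $\phi$ is $(I,\psi,\ell)$ with $I=\bigcup_{w\in V(H)\setminus S}\mathrm{lab}(w)$, $\psi:[k]\to[n]_0$, $\psi(t)=|\phi^{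 -1}(t)|$, $\ell=|M|$. The set of footprints of $(H,\mathrm{lab})$ is the set of footprints over all partial solutions and all their label choices. -}

module Defs where

open import Data.Nat using (ℕ; zero; suc; _+_; _∸_)
open import Data.Bool using (Bool; true; false; if_then_else_; _∧_; not)
open import Data.Fin using (Fin; zero; suc; _≟_)
open import Data.Fin.Subset using (Subset; _∪_; ⁅_⁆; ⊥)
open import Data.Vec using (lookup)
open import Data.List using (List; []; _∷_; length; concatMap)
open import Data.Bool.ListAction using (any)
open import Data.List.Relation.Unary.All using (All)
open import Data.List.Relation.Unary.Unique.Propositional using (Unique)
open import Data.Product using (Σ; _×_; _,_; proj₁; proj₂)
open import Data.Sum using (_⊎_)
open import Relation.Binary.PropositionalEquality using (_≡_)
open import Relation.Nullary.Decidable using (⌊_⌋)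

record Graph (m : ℕ) : Set where
  field
    adj   : Fin m → Fin m → Bool
    sym   : ∀ u v → adj u v ≡ adj v u
    irrefl : ∀ v → adj v v ≡ false
open Graph public

record LabGraph (k m : ℕ) : Set where
  constructor _,ₗ_
  field
    graph : Graph m
    lab   : Fin m → Subset k
open LabGraph public

ρ : ∀ {k m} → Fin k → Fin k → LabGraph k m → LabGraph k m
ρ i j (G ,ₗ l) = G ,ₗ (λ w → if lookup (l w) i then l w ∪ ⁅ j ⁆ else l w)

countV : ∀ {m} → (Fin m → Bool) → ℕ
countV {zero}  p = 0
countV {suc m} p = (if p zero then 1 else 0) + countV (λ w → p (suc w))

unionV : ∀ {k m} → (Fin m → Subset k) → Subset k
unionV {k} {zero}  f = ⊥
unionV {k} {suc m} f = f zero ∪ unionV (λ w → f (suc w))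

ends : ∀ {m} → List (Fin m × Fin m) → List (Fin m)
ends = concatMap (λ e → proj₁ e ∷ proj₂ e ∷ [])

inVM : ∀ {m} → Fin m → List (Fin m × Fin m) → Bool
inVM w M = any (λ x → ⌊ w ≟ x ⌋) (ends M)

IsVertexCover : ∀ {m} → Graph m → Subset m → Set
IsVertexCover G S = ∀ u v → adj G u v ≡ true → (lookup S u ≡ true) ⊎ (lookup S v ≡ true)

IsMatching : ∀ {m} → Graph m → List (Fin m × Fin m) → Set
IsMatching G M = All (λ e → adj G (proj₁ e) (proj₂ e) ≡ true) M × Unique (ends M)

inSminusVM : ∀ {m} → Subset m → List (Fin m × Fin m) → Fin m → Bool
inSminusVM S M w = lookup S w ∧ not (inVM w M)

Footprint : ℕ → Set
Footprint k = Subset k × (Fin k → ℕ) × ℕ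

-- (I, ψ, ℓ) is a footprint of (H, lab): there is a partial solution (S, M)
-- and a label choice φ (only its values on S \ V(M) matter) producing it.
IsFootprint : ∀ {k m} → LabGraph k m → Footprint k → Set
IsFootprint {k} {m} (G ,ₗ l) (I , ψ , ℓ) =
  Σ (Subset m) λ S → Σ (List (Fin m × Fin m)) λ M → Σ (Fin m → Fin k) λ φ →
    IsVertexCover G S × IsMatching G M
    × (∀ w → inVM w M ≡ true → lookup S w ≡ true)
    × (∀ w → inSminusVM S M w ≡ true → lookup (l w) (φ w) ≡ true)
    × (I ≡ unionV (λ w → if lookup S w then ⊥ else l w))
    × (∀ t → ψ t ≡ countV (λ w → inSminusVM S M w ∧ ⌊ φ w ≟ t ⌋))
    × (ℓ ≡ length M)

tildeI : ∀ {k} → Fin k → Fin k → Subset k → Subset k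
tildeI i j I = if lookup I i then I ∪ ⁅ j ⁆ else I

shiftψ : ∀ {k} → Fin k → Fin k → ℕ → (Fin k → ℕ) → Fin k → ℕ
shiftψ i j r ψ t =
  if ⌊ t ≟ i ⌋ then ψ i ∸ r else (if ⌊ t ≟ j ⌋ then ψ j + r else ψ t)

-- A label choice for ρ_{i→{i,j}}(G, lab) is one for (G, lab) except at vertices that chose
-- the label j added by ρ; their label sets contain i.  Sending those vertices back to i gives
-- a label choice for (G, lab); conversely, sending any r of the vertices labelled i to j gives
-- one for the relabelled graph.  Such a rerouting moves r from ψ(i) to ψ(j) and changes
-- nothing else, while (S, M), hence ℓ, is untouched and the labels outside S become Ĩ.
module Submission where

open import Defs hiding (sym)
open import Algebra.Bundles using (CommutativeMonoid)
import Algebra.Properties.CommutativeSemigroup as CommutativeSemigroupProperties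
open import Data.Bool using (Bool; true; false; if_then_else_; _∧_; _∨_; not)
open import Data.Bool.Properties using (∨-zeroʳ)
open import Data.Fin using (Fin; zero; suc; _≟_)
open import Data.Fin.Subset using (Subset; _∪_; ⁅_⁆; ⊥)
open import Data.Fin.Subset.Properties
  using (∪-identityˡ; ∪-identityʳ; ∪-idem; ∪-commutativeMonoid; x∈⁅x⁆; x∈⁅y⁆⇒x≡y)
open import Data.Nat using (ℕ; zero; suc; _+_; _∸_; _≤_; z≤n; s≤s⁻¹)
open import Data.Nat.Properties using (+-identityʳ; m+n∸n≡m; m≤n+m; +-commutativeSemigroup)
open import Data.Product using (Σ; _×_; _,_; proj₁; proj₂)
open import Data.Vec using (lookup)
open import Data.Vec.Properties using (lookup-zipWith; lookup-replicate; lookup⇒[]=; []=⇒lookup)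
open import Function.Bundles using (_⇔_; mk⇔)
open import Relation.Binary.PropositionalEquality
  using (_≡_; refl; sym; trans; cong; cong₂; subst; module ≡-Reasoning)
open import Relation.Nullary using (¬_; yes; no)
open import Relation.Nullary.Decidable using (⌊_⌋)
open import Data.Empty using (⊥-elim)

open ≡-Reasoning

≟-refl : ∀ {k} (x : Fin k) → ⌊ x ≟ x ⌋ ≡ true
≟-refl x with x ≟ x
... | yes _ = refl
... | no x≢x = ⊥-elim (x≢x refl)

≟-≢ : ∀ {k} {x y : Fin k} → ¬ x ≡ y → ⌊ x ≟ y ⌋ ≡ false
≟-≢ {x = x} {y} x≢y with x ≟ y
... | yes x≡y = ⊥-elim (x≢y x≡y)
... | no _ = refl

≟-sound : ∀ {k} {x y : Fin k} → ⌊ x ≟ y ⌋ ≡ true → x ≡ y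
≟-sound {x = x} {y} h with x ≟ y
... | yes x≡y = x≡y

∧-true : ∀ {a b} → a ∧ b ≡ true → a ≡ true × b ≡ true
∧-true {true} {true} _ = refl , refl

indicator : Bool → ℕ
indicator b = if b then 1 else 0

countV-cong : ∀ {m} {p q : Fin m → Bool} → (∀ w → p w ≡ q w) → countV p ≡ countV q
countV-cong {zero} h = refl
countV-cong {suc m} h = cong₂ (λ b c → indicator b + c) (h zero) (countV-cong (λ w → h (suc w)))

countV-+ : ∀ {m} {p q r : Fin m → Bool} →
  (∀ w → indicator (p w) + indicator (q w) ≡ indicator (r w)) → countV p + countV q ≡ countV r
countV-+ {zero} h = refl
countV-+ {suc m} {p} {q} h =
  trans (interchange (indicator (p zero)) (countV (λ w → p (suc w)))
                     (indicator (q zero)) (countV (λ w → q (suc w))))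
        (cong₂ _+_ (h zero) (countV-+ (λ w → h (suc w))))
  where open CommutativeSemigroupProperties +-commutativeSemigroup using (interchange)

countV-choose : ∀ {m} (p : Fin m → Bool) {r} → r ≤ countV p →
  Σ (Fin m → Bool) λ q → (∀ w → q w ≡ true → p w ≡ true) × countV q ≡ r
countV-choose {zero} p z≤n = (λ ()) , (λ ()) , refl
countV-choose {suc m} p {r} r≤ with p zero in p₀ | r
... | true | suc r′ with countV-choose (λ w → p (suc w)) (s≤s⁻¹ r≤)
...   | q , q⊆p , ∣q∣ = (λ { zero → true ; (suc w) → q w }) ,
                        (λ { zero _ → p₀ ; (suc w) → q⊆p w }) , cong suc ∣q∣
countV-choose {suc m} p r≤ | true | zero with countV-choose (λ w → p (suc w)) z≤n
...   | q , q⊆p , ∣q∣ = (λ { zero → false ; (suc w) → q w }) ,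
                        (λ { zero () ; (suc w) → q⊆p w }) , ∣q∣
countV-choose {suc m} p r≤ | false | _ with countV-choose (λ w → p (suc w)) r≤
...   | q , q⊆p , ∣q∣ = (λ { zero → false ; (suc w) → q w }) ,
                        (λ { zero () ; (suc w) → q⊆p w }) , ∣q∣

unionV-cong : ∀ {k m} {f g : Fin m → Subset k} → (∀ w → f w ≡ g w) → unionV f ≡ unionV g
unionV-cong {m = zero} h = refl
unionV-cong {m = suc m} h = cong₂ _∪_ (h zero) (unionV-cong (λ w → h (suc w)))

lookup-∪ : ∀ {k} (A B : Subset k) x → lookup (A ∪ B) x ≡ lookup A x ∨ lookup B x
lookup-∪ A B x = lookup-zipWith _∨_ x A B

lookup-⊥ : ∀ {k} (x : Fin k) → lookup (⊥ {k}) x ≡ false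
lookup-⊥ x = lookup-replicate x false

outsideLabels : ∀ {k m} → Subset m → (Fin m → Subset k) → Subset k
outsideLabels S l = unionV (λ w → if lookup S w then ⊥ else l w)

module _ {k} (i j : Fin k) where

  -- Ĩ = I ∪ mark I, and mark is a join-homomorphism because lookup _ i is one.
  mark : Subset k → Subset k
  mark A = if lookup A i then ⁅ j ⁆ else ⊥

  tildeI≡∪mark : ∀ A → tildeI i j A ≡ A ∪ mark A
  tildeI≡∪mark A with lookup A i
  ... | true = refl
  ... | false = sym (∪-identityʳ A)

  mark-∪ : ∀ A B → mark (A ∪ B) ≡ mark A ∪ mark B
  mark-∪ A B rewrite lookup-∪ A B i with lookup A i | lookup B i
  ... | true | true = sym (∪-idem ⁅ j ⁆)
  ... | true | false = sym (∪-identityʳ ⁅ j ⁆)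
  ... | false | true = sym (∪-identityˡ ⁅ j ⁆)
  ... | false | false = sym (∪-idem ⊥)

  tildeI-∪ : ∀ A B → tildeI i j (A ∪ B) ≡ tildeI i j A ∪ tildeI i j B
  tildeI-∪ A B = begin
    tildeI i j (A ∪ B)              ≡⟨ tildeI≡∪mark (A ∪ B) ⟩
    (A ∪ B) ∪ mark (A ∪ B)          ≡⟨ cong ((A ∪ B) ∪_) (mark-∪ A B) ⟩
    (A ∪ B) ∪ (mark A ∪ mark B)     ≡⟨ interchange A B (mark A) (mark B) ⟩
    (A ∪ mark A) ∪ (B ∪ mark B)     ≡⟨ sym (cong₂ _∪_ (tildeI≡∪mark A) (tildeI≡∪mark B)) ⟩
    tildeI i j A ∪ tildeI i j B     ∎
    where open CommutativeSemigroupProperties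
                 (CommutativeMonoid.commutativeSemigroup (∪-commutativeMonoid k))
                 using (interchange)

  tildeI-⊥ : tildeI i j ⊥ ≡ ⊥
  tildeI-⊥ rewrite lookup-⊥ i = refl

  unionV-tildeI : ∀ {m} (f : Fin m → Subset k) → unionV (λ w → tildeI i j (f w)) ≡ tildeI i j (unionV f)
  unionV-tildeI {zero} f = sym tildeI-⊥
  unionV-tildeI {suc m} f = begin
    tildeI i j (f zero) ∪ unionV (λ w → tildeI i j (f (suc w)))
      ≡⟨ cong (tildeI i j (f zero) ∪_) (unionV-tildeI (λ w → f (suc w))) ⟩
    tildeI i j (f zero) ∪ tildeI i j (unionV (λ w → f (suc w)))
      ≡⟨ sym (tildeI-∪ (f zero) _) ⟩
    tildeI i j (unionV f) ∎

  outsideLabels-tildeI : ∀ {m} (S : Subset m) (l : Fin m → Subset k) →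
    outsideLabels S (λ w → tildeI i j (l w)) ≡ tildeI i j (outsideLabels S l)
  outsideLabels-tildeI S l =
    trans (unionV-cong outside-tildeI) (unionV-tildeI (λ w → if lookup S w then ⊥ else l w))
    where
    outside-tildeI : ∀ w → (if lookup S w then ⊥ else tildeI i j (l w))
                           ≡ tildeI i j (if lookup S w then ⊥ else l w)
    outside-tildeI w with lookup S w
    ... | true = sym tildeI-⊥
    ... | false = refl

  ∈-tildeI⁺ : ∀ L {a} → lookup L a ≡ true → lookup (tildeI i j L) a ≡ true
  ∈-tildeI⁺ L {a} a∈L with lookup L i
  ... | true rewrite lookup-∪ L ⁅ j ⁆ a | a∈L = refl
  ... | false = a∈L

  j∈tildeI : ∀ L → lookup L i ≡ true → lookup (tildeI i j L) j ≡ true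
  j∈tildeI L i∈L rewrite i∈L | lookup-∪ L ⁅ j ⁆ j | []=⇒lookup (x∈⁅x⁆ j) = ∨-zeroʳ (lookup L j)

  ∈-tildeI⁻ : ∀ L {a} → lookup (tildeI i j L) a ≡ true → lookup L a ≡ false →
    a ≡ j × lookup L i ≡ true
  ∈-tildeI⁻ L {a} a∈L̃ a∉L with lookup L i
  ... | false with () ← trans (sym a∈L̃) a∉L
  ... | true rewrite lookup-∪ L ⁅ j ⁆ a | a∉L = x∈⁅y⁆⇒x≡y j (lookup⇒[]= a ⁅ j ⁆ a∈L̃) , refl

  shiftψ-cong : ∀ r {ψ χ : Fin k → ℕ} → (∀ t → ψ t ≡ χ t) → ∀ t → shiftψ i j r ψ t ≡ shiftψ i j r χ t
  shiftψ-cong r ψ≗χ t with ⌊ t ≟ i ⌋ | ⌊ t ≟ j ⌋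
  ... | true | _ = cong (_∸ r) (ψ≗χ i)
  ... | false | true = cong (_+ r) (ψ≗χ j)
  ... | false | false = ψ≗χ t

module Rerouting {k m} (i j : Fin k) (i≢j : ¬ i ≡ j) (D : Fin m → Bool) where

  labelCount : (Fin m → Fin k) → Fin k → ℕ
  labelCount φ t = countV (λ w → D w ∧ ⌊ φ w ≟ t ⌋)

  labelCount-cong : ∀ {φ φ′ : Fin m → Fin k} → (∀ w → D w ≡ true → φ w ≡ φ′ w) →
    ∀ t → labelCount φ t ≡ labelCount φ′ t
  labelCount-cong {φ} {φ′} φ≗φ′ t = countV-cong agree
    where
    agree : ∀ w → D w ∧ ⌊ φ w ≟ t ⌋ ≡ D w ∧ ⌊ φ′ w ≟ t ⌋
    agree w with D w in Dw
    ... | false = refl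
    ... | true = cong (λ a → ⌊ a ≟ t ⌋) (φ≗φ′ w Dw)

  reroute : (Fin m → Bool) → (Fin m → Fin k) → Fin m → Fin k
  reroute R φ w = if R w then j else φ w

  module _ (R : Fin m → Bool) (φ : Fin m → Fin k)
           (R⊆D∩φ⁻¹i : ∀ w → R w ≡ true → D w ≡ true × φ w ≡ i) where

    private
      at-i : ∀ w → indicator (D w ∧ ⌊ reroute R φ w ≟ i ⌋) + indicator (R w)
                   ≡ indicator (D w ∧ ⌊ φ w ≟ i ⌋)
      at-i w with R w in Rw
      ... | false = +-identityʳ _
      ... | true with R⊆D∩φ⁻¹i w Rw
      ...   | Dw , φw≡i rewrite Dw | φw≡i | ≟-≢ (λ j≡i → i≢j (sym j≡i)) | ≟-refl i = refl

      at-j : ∀ w → indicator (D w ∧ ⌊ φ w ≟ j ⌋) + indicator (R w)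
                   ≡ indicator (D w ∧ ⌊ reroute R φ w ≟ j ⌋)
      at-j w with R w in Rw
      ... | false = +-identityʳ _
      ... | true with R⊆D∩φ⁻¹i w Rw
      ...   | Dw , φw≡i rewrite Dw | φw≡i | ≟-≢ i≢j | ≟-refl j = refl

      elsewhere : ∀ t → ¬ t ≡ i → ¬ t ≡ j → ∀ w →
                  D w ∧ ⌊ reroute R φ w ≟ t ⌋ ≡ D w ∧ ⌊ φ w ≟ t ⌋
      elsewhere t t≢i t≢j w with R w in Rw
      ... | false = refl
      ... | true with R⊆D∩φ⁻¹i w Rw
      ...   | _ , φw≡i rewrite φw≡i | ≟-≢ (λ j≡t → t≢j (sym j≡t)) | ≟-≢ (λ i≡t → t≢i (sym i≡t)) = refl

    countV-reroute≤ : countV R ≤ labelCount φ i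
    countV-reroute≤ = subst (countV R ≤_) (countV-+ at-i) (m≤n+m _ _)

    labelCount-reroute : ∀ t → labelCount (reroute R φ) t ≡ shiftψ i j (countV R) (labelCount φ) t
    labelCount-reroute t with t ≟ i | t ≟ j
    ... | yes refl | _ = begin
      labelCount (reroute R φ) i                           ≡⟨ m+n∸n≡m _ (countV R) ⟨
      labelCount (reroute R φ) i + countV R ∸ countV R     ≡⟨ cong (_∸ countV R) (countV-+ at-i) ⟩
      labelCount φ i ∸ countV R                            ∎
    ... | no _ | yes refl = sym (countV-+ at-j)
    ... | no t≢i | no t≢j = countV-cong (elsewhere t t≢i t≢j)

IsShiftedFootprint : ∀ {k m} → Fin k → Fin k → LabGraph k m → Footprint k → Set
IsShiftedFootprint {k} i j Gy (I' , ψ' , ℓ') =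
  Σ (Footprint k) λ { (I , ψ , ℓ) → Σ ℕ λ r →
    IsFootprint Gy (I , ψ , ℓ) × r ≤ ψ i
    × I' ≡ tildeI i j I × (∀ t → ψ' t ≡ shiftψ i j r ψ t) × ℓ' ≡ ℓ }

module _ {k m} (i j : Fin k) (i≢j : ¬ i ≡ j) (G : Graph m) (l : Fin m → Subset k) where

  footprint-ρ⇒shifted : ∀ {I' ψ' ℓ'} →
    IsFootprint (ρ i j (G ,ₗ l)) (I' , ψ' , ℓ') → IsShiftedFootprint i j (G ,ₗ l) (I' , ψ' , ℓ')
  footprint-ρ⇒shifted {I'} {ψ'} {ℓ'} (S , M , φ̃ , cover , matching , VM⊆S , φ̃∈lab , I'≡ , ψ'≡ , ℓ'≡) =
    (outsideLabels S l , labelCount φ , ℓ') , countV stray ,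
    (S , M , φ , cover , matching , VM⊆S , φ∈lab , refl , (λ _ → refl) , ℓ'≡) ,
    countV-reroute≤ stray φ stray⊆D∩φ⁻¹i , trans I'≡ (outsideLabels-tildeI i j S l) , ψ'-shift , refl
    where
    D : Fin m → Bool
    D = inSminusVM S M
    open Rerouting i j i≢j D

    φ : Fin m → Fin k
    φ w = if lookup (l w) (φ̃ w) then φ̃ w else i

    stray : Fin m → Bool
    stray w = D w ∧ not (lookup (l w) (φ̃ w))

    φ∈lab : ∀ w → D w ≡ true → lookup (l w) (φ w) ≡ true
    φ∈lab w Dw with lookup (l w) (φ̃ w) in φ̃w∈l
    ... | true = φ̃w∈l
    ... | false = proj₂ (∈-tildeI⁻ i j (l w) (φ̃∈lab w Dw) φ̃w∈l)

    stray⊆D∩φ⁻¹i : ∀ w → stray w ≡ true → D w ≡ true × φ w ≡ i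
    stray⊆D∩φ⁻¹i w strayw with D w | lookup (l w) (φ̃ w)
    ... | true | false = refl , refl

    φ̃≡reroute : ∀ w → D w ≡ true → φ̃ w ≡ reroute stray φ w
    φ̃≡reroute w Dw rewrite Dw with lookup (l w) (φ̃ w) in φ̃w∈l
    ... | true = refl
    ... | false = proj₁ (∈-tildeI⁻ i j (l w) (φ̃∈lab w Dw) φ̃w∈l)

    ψ'-shift : ∀ t → ψ' t ≡ shiftψ i j (countV stray) (labelCount φ) t
    ψ'-shift t = begin
      ψ' t                                          ≡⟨ ψ'≡ t ⟩
      labelCount φ̃ t                               ≡⟨ labelCount-cong φ̃≡reroute t ⟩
      labelCount (reroute stray φ) t                ≡⟨ labelCount-reroute stray φ stray⊆D∩φ⁻¹i t ⟩
      shiftψ i j (countV stray) (labelCount φ) t    ∎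

  shifted⇒footprint-ρ : ∀ {I' ψ' ℓ'} →
    IsShiftedFootprint i j (G ,ₗ l) (I' , ψ' , ℓ') → IsFootprint (ρ i j (G ,ₗ l)) (I' , ψ' , ℓ')
  shifted⇒footprint-ρ {I'} {ψ'} {ℓ'}
    ((I , ψ , ℓ) , r , (S , M , φ , cover , matching , VM⊆S , φ∈lab , I≡ , ψ≡ , ℓ≡) , r≤ψi , I'≡ , ψ'≡ , ℓ'≡ℓ) =
    S , M , reroute R φ , cover , matching , VM⊆S , rerouted∈lab ,
    trans I'≡ (trans (cong (tildeI i j) I≡) (sym (outsideLabels-tildeI i j S l))) ,
    ψ'-count , trans ℓ'≡ℓ ℓ≡
    where
    D : Fin m → Bool
    D = inSminusVM S M
    open Rerouting i j i≢j D

    chosen : Σ (Fin m → Bool) λ R → (∀ w → R w ≡ true → D w ∧ ⌊ φ w ≟ i ⌋ ≡ true) × countV R ≡ r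
    chosen = countV-choose (λ w → D w ∧ ⌊ φ w ≟ i ⌋) (subst (r ≤_) (ψ≡ i) r≤ψi)

    R : Fin m → Bool
    R = proj₁ chosen

    R⊆D∩φ⁻¹i : ∀ w → R w ≡ true → D w ≡ true × φ w ≡ i
    R⊆D∩φ⁻¹i w Rw with Dw , φw≟i ← ∧-true (proj₁ (proj₂ chosen) w Rw) = Dw , ≟-sound φw≟i

    ∣R∣≡r : countV R ≡ r
    ∣R∣≡r = proj₂ (proj₂ chosen)

    rerouted∈lab : ∀ w → D w ≡ true → lookup (tildeI i j (l w)) (reroute R φ w) ≡ true
    rerouted∈lab w Dw with R w in Rw
    ... | true = j∈tildeI i j (l w) (subst (λ a → lookup (l w) a ≡ true) (proj₂ (R⊆D∩φ⁻¹i w Rw)) (φ∈lab w Dw))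
    ... | false = ∈-tildeI⁺ i j (l w) (φ∈lab w Dw)

    ψ'-count : ∀ t → ψ' t ≡ labelCount (reroute R φ) t
    ψ'-count t = begin
      ψ' t                                        ≡⟨ ψ'≡ t ⟩
      shiftψ i j r ψ t                            ≡⟨ shiftψ-cong i j r ψ≡ t ⟩
      shiftψ i j r (labelCount φ) t               ≡⟨ cong (λ s → shiftψ i j s (labelCount φ) t) ∣R∣≡r ⟨
      shiftψ i j (countV R) (labelCount φ) t      ≡⟨ labelCount-reroute R φ R⊆D∩φ⁻¹i t ⟨
      labelCount (reroute R φ) t                  ∎

mainTheorem13 : (n k m : ℕ) → m ≤ n → (i j : Fin k) → ¬ (i ≡ j) →
    (Gy : LabGraph k m) → (I' : _) → (ψ' : Fin k → ℕ) → (ℓ' : ℕ) →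
    IsFootprint (ρ i j Gy) (I' , ψ' , ℓ')
    ⇔ Σ (Footprint k) λ { (I , ψ , ℓ) → Σ ℕ λ r →
        IsFootprint Gy (I , ψ , ℓ) × r ≤ ψ i
        × I' ≡ tildeI i j I × (∀ t → ψ' t ≡ shiftψ i j r ψ t) × ℓ' ≡ ℓ }
mainTheorem13 _ _ _ _ i j i≢j (G ,ₗ l) _ _ _ =
  mk⇔ (footprint-ρ⇒shifted i j i≢j G l) (shifted⇒footprint-ρ i j i≢j G l)
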